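{- Let $X=\mathbb{P}^3(\mathbb{F}_2)$, regarded as a subset of $Y=\mathbb{P}^3(\mathbb{F}_{2^4})$ via the inclusion $\mathbb{F}_2\subset\mathbb{F}_{16}$. Let $Z\subseteq Y$ be the union of all planes of $Y$ spanned by triples of non-collinear points of $X$. Then $W:=Y\setminus Z$ is non-empty. -}

module Defs where

open import Data.Bool using (Bool; true; false; _∧_; _xor_)
open import Data.Vec using (Vec; []; _∷_; map; zipWith; replicate)
open import Data.Product using (Σ; ∃; _×_; _,_)
open import Relation.Binary.PropositionalEquality using (_≡_)
open import Relation.Nullary using (¬_)

F₂ : Set
F₂ = Bool

-- The field F₁₆ = F₂[α]/(α⁴ + α + 1)  (α⁴+α+1 is irreducible over F₂).
-- The element ⟨ c0 , c1 , c2 , c3 ⟩ denotes c0 + c1 α + c2 α² + c3 α³.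

record F₁₆ : Set where
  constructor ⟨_,_,_,_⟩
  field
    c0 c1 c2 c3 : Bool

0F : F₁₆
0F = ⟨ false , false , false , false ⟩

_+F_ : F₁₆ → F₁₆ → F₁₆
⟨ a0 , a1 , a2 , a3 ⟩ +F ⟨ b0 , b1 , b2 , b3 ⟩ =
  ⟨ a0 xor b0 , a1 xor b1 , a2 xor b2 , a3 xor b3 ⟩

-- multiplication: polynomial product, then reduce with
-- α⁴ = 1 + α, α⁵ = α + α², α⁶ = α² + α³.
_*F_ : F₁₆ → F₁₆ → F₁₆
⟨ a0 , a1 , a2 , a3 ⟩ *F ⟨ b0 , b1 , b2 , b3 ⟩ =
  ⟨ d0 xor d4 , d1 xor (d4 xor d5) , d2 xor (d5 xor d6) , d3 xor d6 ⟩
  where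
    d0 = a0 ∧ b0
    d1 = (a0 ∧ b1) xor (a1 ∧ b0)
    d2 = (a0 ∧ b2) xor ((a1 ∧ b1) xor (a2 ∧ b0))
    d3 = (a0 ∧ b3) xor ((a1 ∧ b2) xor ((a2 ∧ b1) xor (a3 ∧ b0)))
    d4 = (a1 ∧ b3) xor ((a2 ∧ b2) xor (a3 ∧ b1))
    d5 = (a2 ∧ b3) xor (a3 ∧ b2)
    d6 = a3 ∧ b3

ι : F₂ → F₁₆
ι b = ⟨ b , false , false , false ⟩

V16 : Set
V16 = Vec F₁₆ 4

V2 : Set
V2 = Vec F₂ 4

zeroV : V16
zeroV = replicate 4 0F

_⊕_ : V16 → V16 → V16
_⊕_ = zipWith _+F_

_·_ : F₁₆ → V16 → V16
a · v = map (a *F_) v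

-- a point of X = P³(F₂) is represented by a nonzero vector of F₂⁴
-- (the only nonzero scalar of F₂ is 1, so this representative is unique);
-- it is regarded as a point of Y via the inclusion F₂ ⊂ F₁₆.
embed : V2 → V16
embed = map ι

IsPointX : V2 → Set
IsPointX p = ¬ (embed p ≡ zeroV)

-- a point of Y = P³(F₁₆) is represented by a nonzero vector of F₁₆⁴;
-- all predicates below are invariant under rescaling the representative.
IsPointY : V16 → Set
IsPointY y = ¬ (y ≡ zeroV)

-- three points of Y are non-collinear iff their representatives are
-- linearly independent over F₁₆
NonCollinear : V16 → V16 → V16 → Set
NonCollinear u v w =
  ∀ (a b c : F₁₆) → (a · u) ⊕ ((b · v) ⊕ (c · w)) ≡ zeroV →
    (a ≡ 0F) × ((b ≡ 0F) × (c ≡ 0F))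

OnPlaneSpannedBy : V16 → V16 → V16 → V16 → Set
OnPlaneSpannedBy u v w y =
  ∃ λ (a : F₁₆) → ∃ λ (b : F₁₆) → ∃ λ (c : F₁₆) →
    y ≡ (a · u) ⊕ ((b · v) ⊕ (c · w))

InZ : V16 → Set
InZ y =
  ∃ λ (p : V2) → ∃ λ (q : V2) → ∃ λ (r : V2) →
    IsPointX p × (IsPointX q × (IsPointX r ×
    (NonCollinear (embed p) (embed q) (embed r) ×
     OnPlaneSpannedBy (embed p) (embed q) (embed r) y)))

InW : V16 → Set
InW y = IsPointY y × ¬ InZ y

-- The witness is y = (1, α, α², α³). Since p, q, r have coordinates in F₂,
-- the k-th coordinate of a·p + b·q + c·r is an F₂-linear combination of
-- a, b, c. So y ∈ Z would put the F₂-basis 1, α, α², α³ of F₁₆ inside the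
-- F₂-span of three elements, which a finite check rules out (dim F₁₆ = 4).
module Submission where

open import Defs
open import Data.Bool using (Bool; true; false; if_then_else_; _≟_)
open import Data.Bool.Properties using (∧-zeroʳ; ∧-identityʳ; xor-identityʳ)
open import Data.Fin.Properties using (all?)
open import Data.Product using (∃; _,_)
open import Data.Sum using (inj₁; inj₂)
open import Data.Vec using (_∷_; []; lookup)
open import Data.Vec.Properties using (lookup-map; lookup-zipWith)
open import Relation.Binary.Definitions using (DecidableEquality)
open import Relation.Binary.PropositionalEquality using (_≡_; refl; cong; cong₂; trans; module ≡-Reasoning)
open ≡-Reasoning
open import Relation.Nullary using (Dec; ¬_; ¬?; _×-dec_; _⊎-dec_; map′; toWitness)
open import Relation.Unary using (Decidable)

1F α α² α³ : F₁₆
1F = ⟨ true , false , false , false ⟩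
α  = ⟨ false , true , false , false ⟩
α² = ⟨ false , false , true , false ⟩
α³ = ⟨ false , false , false , true ⟩

*F-zeroʳ : ∀ a → a *F 0F ≡ 0F
*F-zeroʳ ⟨ a0 , a1 , a2 , a3 ⟩
  rewrite ∧-zeroʳ a0 | ∧-zeroʳ a1 | ∧-zeroʳ a2 | ∧-zeroʳ a3 = refl

*F-identityʳ : ∀ a → a *F 1F ≡ a
*F-identityʳ ⟨ a0 , a1 , a2 , a3 ⟩
  rewrite ∧-zeroʳ a0 | ∧-zeroʳ a1 | ∧-zeroʳ a2 | ∧-zeroʳ a3
        | ∧-identityʳ a0 | ∧-identityʳ a1 | ∧-identityʳ a2 | ∧-identityʳ a3
        | xor-identityʳ a0 | xor-identityʳ a1 | xor-identityʳ a2 | xor-identityʳ a3 = refl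

_≟F_ : DecidableEquality F₁₆
⟨ a0 , a1 , a2 , a3 ⟩ ≟F ⟨ b0 , b1 , b2 , b3 ⟩ =
  map′ (λ { (refl , refl , refl , refl) → refl })
       (λ { refl → refl , refl , refl , refl })
       (a0 ≟ b0 ×-dec a1 ≟ b1 ×-dec a2 ≟ b2 ×-dec a3 ≟ b3)

∀-Bool? : {P : Bool → Set} → Decidable P → Dec (∀ x → P x)
∀-Bool? P? = map′ (λ { (t , f) true → t ; (t , f) false → f })
                  (λ h → h true , h false)
                  (P? true ×-dec P? false)

∃-Bool? : {P : Bool → Set} → Decidable P → Dec (∃ P)
∃-Bool? P? = map′ (λ { (inj₁ t) → true , t ; (inj₂ f) → false , f })
                  (λ { (true , t) → inj₁ t ; (false , f) → inj₂ f })
                  (P? true ⊎-dec P? false)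

∀-F₁₆? : {P : F₁₆ → Set} → Decidable P → Dec (∀ a → P a)
∀-F₁₆? P? =
  map′ (λ h → λ { ⟨ a0 , a1 , a2 , a3 ⟩ → h a0 a1 a2 a3 })
       (λ h a0 a1 a2 a3 → h ⟨ a0 , a1 , a2 , a3 ⟩)
       (∀-Bool? λ a0 → ∀-Bool? λ a1 → ∀-Bool? λ a2 → ∀-Bool? λ a3 → P? ⟨ a0 , a1 , a2 , a3 ⟩)

_⊙_ : F₂ → F₁₆ → F₁₆
x ⊙ a = if x then a else 0F

*F-ι : ∀ a x → a *F ι x ≡ x ⊙ a
*F-ι a true  = *F-identityʳ a
*F-ι a false = *F-zeroʳ a

InF₂Span : F₁₆ → F₁₆ → F₁₆ → F₁₆ → Set
InF₂Span a b c t = ∃ λ x → ∃ λ y → ∃ λ z → t ≡ (x ⊙ a) +F ((y ⊙ b) +F (z ⊙ c))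

inF₂Span? : ∀ a b c → Decidable (InF₂Span a b c)
inF₂Span? a b c t =
  ∃-Bool? λ x → ∃-Bool? λ y → ∃-Bool? λ z → t ≟F ((x ⊙ a) +F ((y ⊙ b) +F (z ⊙ c)))

αPowers : V16
αPowers = 1F ∷ α ∷ α² ∷ α³ ∷ []

αPowers-not-in-F₂-span : ∀ a b c → ¬ (∀ k → InF₂Span a b c (lookup αPowers k))
αPowers-not-in-F₂-span = toWitness {a? = decision} _
  where
  decision : Dec (∀ a b c → ¬ (∀ k → InF₂Span a b c (lookup αPowers k)))
  decision = ∀-F₁₆? λ a → ∀-F₁₆? λ b → ∀-F₁₆? λ c →
             ¬? (all? λ k → inF₂Span? a b c (lookup αPowers k))

lookup-scale-embed : ∀ a (p : V2) k → lookup (a · embed p) k ≡ lookup p k ⊙ a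
lookup-scale-embed a p k = begin
  lookup (a · embed p) k    ≡⟨ lookup-map k (a *F_) (embed p) ⟩
  a *F lookup (embed p) k   ≡⟨ cong (a *F_) (lookup-map k ι p) ⟩
  a *F ι (lookup p k)       ≡⟨ *F-ι a (lookup p k) ⟩
  lookup p k ⊙ a            ∎

lookup-combination : ∀ (p q r : V2) a b c k →
  lookup ((a · embed p) ⊕ ((b · embed q) ⊕ (c · embed r))) k
  ≡ (lookup p k ⊙ a) +F ((lookup q k ⊙ b) +F (lookup r k ⊙ c))
lookup-combination p q r a b c k =
  trans (lookup-zipWith _+F_ k (a · embed p) _)
        (cong₂ _+F_ (lookup-scale-embed a p k)
                    (trans (lookup-zipWith _+F_ k (b · embed q) (c · embed r))
                           (cong₂ _+F_ (lookup-scale-embed b q k) (lookup-scale-embed c r k))))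

coordinates-in-F₂-span : ∀ (p q r : V2) a b c y →
  y ≡ (a · embed p) ⊕ ((b · embed q) ⊕ (c · embed r)) → ∀ k → InF₂Span a b c (lookup y k)
coordinates-in-F₂-span p q r a b c y refl k =
  lookup p k , lookup q k , lookup r k , lookup-combination p q r a b c k

αPowers∉Z : ¬ InZ αPowers
αPowers∉Z (p , q , r , _ , _ , _ , _ , a , b , c , αPowers≡) =
  αPowers-not-in-F₂-span a b c (coordinates-in-F₂-span p q r a b c αPowers αPowers≡)

mainTheorem3 : ∃ λ (y : V16) → InW y
mainTheorem3 = αPowers , (λ ()) , αPowers∉Z
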